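{- For every integer $n\geq 2$ and every integer $k\geq 3$, the distinguishing index of the dutch windmill graph $D_n^k$ is $$D'(D_n^k)=\min\left\{r\in\mathbb{N}:~\frac{r^{k}-r^{\lceil k/2 \rceil}}{2}\geq n\right\}.$$
   Context: All graphs are simple. The dutch windmill graph $D_n^k$ ($n\geq 2$, $k\geq 3$) is the graph obtained by taking $n$ copies of the cycle $C_k$ and identifying one vertex from each copy into a single common (central) vertex. The distinguishing index $D'(G)$ of a graph $G$ is the least number $d$ such that there is a labeling of the edges of $G$ with $d$ labels that is preserved only by the identity automorphism of $G$. -}

module Defs where

open import Level using (Level; _⊔_) renaming (suc to lsuc)
open import Data.Nat using (ℕ; _+_; _∸_; _^_; _≤_; _<_; _/_; ⌈_/2⌉)
open import Data.Fin using (Fin; toℕ)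
open import Data.Unit using (⊤; tt)
open import Data.Empty using (⊥)
open import Data.Sum using (_⊎_; inj₁; inj₂)
open import Data.Product using (Σ; _×_; _,_; ∃)
open import Relation.Nullary using (¬_)
open import Relation.Binary.PropositionalEquality using (_≡_)

record Graph : Set₁ where
  field
    V     : Set
    Adj   : V → V → Set
    sym   : ∀ {u v} → Adj u v → Adj v u
    irrefl : ∀ {v} → ¬ Adj v v

record Automorphism (G : Graph) : Set where
  open Graph G
  field
    fun     : V → V
    inv     : V → V
    invˡ    : ∀ v → inv (fun v) ≡ v
    invʳ    : ∀ v → fun (inv v) ≡ v
    pres    : ∀ {u v} → Adj u v → Adj (fun u) (fun v)
    reflect : ∀ {u v} → Adj (fun u) (fun v) → Adj u v

-- Encoded as a function on vertex pairs, symmetric on edges (an edge is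
-- unordered); values on non-adjacent pairs are irrelevant.
record EdgeLabeling (G : Graph) (d : ℕ) : Set where
  open Graph G
  field
    label    : V → V → Fin d
    labelSym : ∀ {u v} → Adj u v → label u v ≡ label v u

Preserves : {G : Graph} {d : ℕ} → Automorphism G → EdgeLabeling G d → Set
Preserves {G} σ ℓ =
  ∀ {u v} → Adj u v → label (fun u) (fun v) ≡ label u v
  where open Graph G ; open Automorphism σ ; open EdgeLabeling ℓ

Distinguishing : {G : Graph} {d : ℕ} → EdgeLabeling G d → Set
Distinguishing {G} ℓ =
  (σ : Automorphism G) → Preserves σ ℓ → ∀ v → Automorphism.fun σ v ≡ v

HasDistinguishingEdgeLabeling : Graph → ℕ → Set
HasDistinguishingEdgeLabeling G d = Σ (EdgeLabeling G d) Distinguishing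

IsLeast : ∀ {ℓ} → (ℕ → Set ℓ) → ℕ → Set ℓ
IsLeast P m = P m × (∀ j → j < m → ¬ P j)

DistinguishingIndexIs : Graph → ℕ → Set
DistinguishingIndexIs G m = IsLeast (HasDistinguishingEdgeLabeling G) m

-- Dutch windmill D_n^k: n copies of C_k sharing a central vertex.
-- Vertices: the centre, or (i , j) meaning position j+1 (in 1..k-1) of the
-- i-th cycle, whose position 0 is the centre.
WVertex : ℕ → ℕ → Set
WVertex n k = ⊤ ⊎ (Fin n × Fin (k ∸ 1))

WAdj : (n k : ℕ) → WVertex n k → WVertex n k → Set
WAdj n k (inj₁ _) (inj₁ _) = ⊥
WAdj n k (inj₁ _) (inj₂ (i , j)) = (toℕ j ≡ 0) ⊎ (toℕ j + 2 ≡ k)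
WAdj n k (inj₂ (i , j)) (inj₁ _) = (toℕ j ≡ 0) ⊎ (toℕ j + 2 ≡ k)
WAdj n k (inj₂ (i , j)) (inj₂ (i' , j')) =
  (i ≡ i') × ((toℕ j + 1 ≡ toℕ j') ⊎ (toℕ j' + 1 ≡ toℕ j))

private
  wsym : ∀ n k {u v} → WAdj n k u v → WAdj n k v u
  wsym n k {inj₁ _} {inj₂ _} a = a
  wsym n k {inj₂ _} {inj₁ _} a = a
  wsym n k {inj₂ _} {inj₂ _} (Relation.Binary.PropositionalEquality.refl , inj₁ e) =
    Relation.Binary.PropositionalEquality.refl , inj₂ e
  wsym n k {inj₂ _} {inj₂ _} (Relation.Binary.PropositionalEquality.refl , inj₂ e) =
    Relation.Binary.PropositionalEquality.refl , inj₁ e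

  n+1≢n : ∀ m → ¬ (m + 1 ≡ m)
  n+1≢n ℕ.zero ()
  n+1≢n (ℕ.suc m) e = n+1≢n m (Data.Nat.Properties.suc-injective e)
    where import Data.Nat.Properties

  wirr : ∀ n k {v} → ¬ WAdj n k v v
  wirr n k {inj₁ _} ()
  wirr n k {inj₂ _} (_ , inj₁ e) = n+1≢n _ e
  wirr n k {inj₂ _} (_ , inj₂ e) = n+1≢n _ e

DutchWindmill : ℕ → ℕ → Graph
DutchWindmill n k = record
  { V = WVertex n k ; Adj = WAdj n k ; sym = wsym n k ; irrefl = wirr n k }

WindmillCond : ℕ → ℕ → ℕ → Set
WindmillCond n k r = n ≤ (r ^ k ∸ r ^ ⌈ k /2⌉) / 2

-- Every automorphism of D_n^k fixes the centre, the only vertex of degree more than two, and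
-- so permutes the n blades (the cycles minus the centre), possibly reversing some of them;
-- conversely, exchanging two blades or reversing one is an automorphism. Reading the labels
-- along a blade from the centre back to the centre gives a word of length k, and a labeling
-- is distinguishing exactly when these n words are pairwise distinct up to reversal and none
-- of them is a palindrome. Among the r^k words over r labels, r^⌈k/2⌉ are palindromes and the
-- others fall into pairs {w, reversal of w}, so there are (r^k − r^⌈k/2⌉)/2 classes to choose
-- from; an explicit system of representatives of these classes makes the count constructive.
module Submission where

open import Data.Bool using (Bool; true; false)
open import Data.Empty using (⊥; ⊥-elim)
open import Data.Fin using (Fin; zero; suc; toℕ; fromℕ<; inject≤; opposite)
open import Data.Fin.Properties as Fin using (0↔⊥; 1↔⊤; +↔⊎; *↔×; injective⇒≤; inject≤-injective)
open import Data.Nat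
  using (ℕ; zero; suc; _+_; _*_; _∸_; _^_; _≤_; _<_; _/_; _⊓_; ⌈_/2⌉; z≤n; s≤s; _≤?_; _<?_)
open import Data.Nat.Properties
open import Data.Nat.DivMod using (m*n/n≡m)
open import Data.Nat.Tactic.RingSolver using (solve-∀)
open import Data.Product using (Σ; _×_; _,_; proj₁; proj₂)
open import Data.Product.Function.NonDependent.Propositional using (_×-↔_)
open import Data.Sum using (_⊎_; inj₁; inj₂)
open import Data.Sum.Function.Propositional using (_⊎-↔_)
open import Data.Unit using (⊤; tt)
open import Function using (_∘_; _↔_; Inverse)
open import Function.Bundles using (Injection)
open import Function.Properties.Inverse using (↔-trans; ↔-refl; ↔-sym; ↔⇒↣)
open import Relation.Nullary using (¬_; Dec; yes; no)
open import Relation.Binary.PropositionalEquality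
open import Defs

mirror : ℕ → ℕ → ℕ
mirror L e = L ∸ suc e

mirror-< : ∀ {L e} → e < L → mirror L e < L
mirror-< {suc L} {e} _ = s≤s (m∸n≤m L e)

mirror-involutive : ∀ {L e} → e < L → mirror L (mirror L e) ≡ e
mirror-involutive {suc L} (s≤s e≤L) = m∸[m∸n]≡n e≤L

∸≡suc-mirror : ∀ {L e} → e < L → L ∸ e ≡ suc (mirror L e)
∸≡suc-mirror = +-∸-assoc 1

-- Unordered pairs of distinct elements of Fin m, each stored as lo < hi.
Pair : ℕ → Set
Pair zero = ⊥
Pair (suc m) = Fin m ⊎ Pair m

lo hi : ∀ {m} → Pair m → Fin m
lo {suc m} (inj₁ _) = zero
lo {suc m} (inj₂ p) = suc (lo p)
hi {suc m} (inj₁ x) = suc x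
hi {suc m} (inj₂ p) = suc (hi p)

lo≢hi : ∀ {m} (p : Pair m) → lo p ≢ hi p
lo≢hi {suc m} (inj₂ p) e = lo≢hi p (Fin.suc-injective e)

lo≢hi-swap : ∀ {m} (p q : Pair m) → lo p ≡ hi q → hi p ≢ lo q
lo≢hi-swap {suc m} (inj₁ _) (inj₁ _) ()
lo≢hi-swap {suc m} (inj₁ _) (inj₂ _) ()
lo≢hi-swap {suc m} (inj₂ p) (inj₁ _) _ ()
lo≢hi-swap {suc m} (inj₂ p) (inj₂ q) e e′ =
  lo≢hi-swap p q (Fin.suc-injective e) (Fin.suc-injective e′)

Pair-≡ : ∀ {m} (p q : Pair m) → lo p ≡ lo q → hi p ≡ hi q → p ≡ q
Pair-≡ {suc m} (inj₁ _) (inj₁ _) _ e = cong inj₁ (Fin.suc-injective e)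
Pair-≡ {suc m} (inj₂ p) (inj₂ q) e e′ =
  cong inj₂ (Pair-≡ p q (Fin.suc-injective e) (Fin.suc-injective e′))

pairOf : ∀ {m} (x y : Fin m) → x ≢ y →
  Σ (Pair m) λ p → (lo p ≡ x × hi p ≡ y) ⊎ (lo p ≡ y × hi p ≡ x)
pairOf zero zero x≢y = ⊥-elim (x≢y refl)
pairOf zero (suc y) _ = inj₁ y , inj₁ (refl , refl)
pairOf (suc x) zero _ = inj₁ x , inj₂ (refl , refl)
pairOf (suc x) (suc y) x≢y with pairOf x y (x≢y ∘ cong suc)
... | p , inj₁ (e , e′) = inj₂ p , inj₁ (cong suc e , cong suc e′)
... | p , inj₂ (e , e′) = inj₂ p , inj₂ (cong suc e , cong suc e′)

triangular : ℕ → ℕ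
triangular zero = 0
triangular (suc m) = m + triangular m

Pair↔ : ∀ m → Fin (triangular m) ↔ Pair m
Pair↔ zero = 0↔⊥
Pair↔ (suc m) = ↔-trans (+↔⊎ {m}) (↔-refl ⊎-↔ Pair↔ m)

triangular-double : ∀ m → triangular m + triangular m + m ≡ m * m
triangular-double zero = refl
triangular-double (suc m) = begin
  (m + t) + (m + t) + suc m  ≡⟨ rearrange m t ⟩
  (t + t + m) + (m + m + 1)  ≡⟨ cong (_+ (m + m + 1)) (triangular-double m) ⟩
  m * m + (m + m + 1)        ≡⟨ square-suc m ⟩
  suc m * suc m              ∎
  where
  open ≡-Reasoning
  t = triangular m
  rearrange : ∀ m t → (m + t) + (m + t) + suc m ≡ (t + t + m) + (m + m + 1)
  rearrange = solve-∀
  square-suc : ∀ m → m * m + (m + m + 1) ≡ suc m * suc m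
  square-suc = solve-∀

module Words (d : ℕ) where

  D : ℕ
  D = suc d

  -- A word of length L is read off the positions below L; the rest is padding, which is why
  -- the alphabet Fin (suc d) is nonempty.
  Word : Set
  Word = ℕ → Fin D

  infix 4 _≈[_]_ _⇄[_]_ _~[_]_

  record _≈[_]_ (w : Word) (L : ℕ) (w′ : Word) : Set where
    constructor mk≈
    field ≈-at : ∀ e → e < L → w e ≡ w′ e

  record _⇄[_]_ (w : Word) (L : ℕ) (w′ : Word) : Set where
    constructor mk⇄
    field ⇄-at : ∀ e → e < L → w e ≡ w′ (mirror L e)

  open _≈[_]_ public
  open _⇄[_]_ public

  _~[_]_ : Word → ℕ → Word → Set
  w ~[ L ] w′ = w ≈[ L ] w′ ⊎ w ⇄[ L ] w′

  DistinctUpToReversal : ∀ {n} → ℕ → (Fin n → Word) → Set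
  DistinctUpToReversal L W = ∀ a b → (W a ≈[ L ] W b → a ≡ b) × ¬ W a ⇄[ L ] W b

  module _ {L : ℕ} {x y : Word} where

    ≈-sym : x ≈[ L ] y → y ≈[ L ] x
    ≈-sym (mk≈ h) = mk≈ λ e lt → sym (h e lt)

    ⇄-sym : x ⇄[ L ] y → y ⇄[ L ] x
    ⇄-sym (mk⇄ h) =
      mk⇄ λ e lt → sym (trans (h (mirror L e) (mirror-< lt)) (cong y (mirror-involutive lt)))

  module _ {L : ℕ} {x y z : Word} where

    ≈-trans : x ≈[ L ] y → y ≈[ L ] z → x ≈[ L ] z
    ≈-trans (mk≈ h) (mk≈ h′) = mk≈ λ e lt → trans (h e lt) (h′ e lt)

    ⇄-trans : x ⇄[ L ] y → y ⇄[ L ] z → x ≈[ L ] z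
    ⇄-trans (mk⇄ h) (mk⇄ h′) = mk≈ λ e lt →
      trans (h e lt) (trans (h′ (mirror L e) (mirror-< lt)) (cong z (mirror-involutive lt)))

    ≈-⇄-trans : x ≈[ L ] y → y ⇄[ L ] z → x ⇄[ L ] z
    ≈-⇄-trans (mk≈ h) (mk⇄ h′) = mk⇄ λ e lt → trans (h e lt) (h′ e lt)

    ⇄-≈-trans : x ⇄[ L ] y → y ≈[ L ] z → x ⇄[ L ] z
    ⇄-≈-trans (mk⇄ h) (mk≈ h′) = mk⇄ λ e lt → trans (h e lt) (h′ (mirror L e) (mirror-< lt))

  ~-sym : ∀ {L x y} → x ~[ L ] y → y ~[ L ] x
  ~-sym (inj₁ h) = inj₁ (≈-sym h)
  ~-sym (inj₂ h) = inj₂ (⇄-sym h)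

  ~-trans : ∀ {L x y z} → x ~[ L ] y → y ~[ L ] z → x ~[ L ] z
  ~-trans (inj₁ h) (inj₁ h′) = inj₁ (≈-trans h h′)
  ~-trans (inj₁ h) (inj₂ h′) = inj₂ (≈-⇄-trans h h′)
  ~-trans (inj₂ h) (inj₁ h′) = inj₂ (⇄-≈-trans h h′)
  ~-trans (inj₂ h) (inj₂ h′) = inj₁ (⇄-trans h h′)

  ~⇒≡ : ∀ {n L} {W : Fin n → Word} → DistinctUpToReversal L W →
    ∀ {a b} → W a ~[ L ] W b → a ≡ b
  ~⇒≡ distinct {a} {b} (inj₁ h) = proj₁ (distinct a b) h
  ~⇒≡ distinct {a} {b} (inj₂ h) = ⊥-elim (proj₂ (distinct a b) h)

  module _ {L : ℕ} {w w′ : Word} where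

    ≈-ends : w ≈[ 2 + L ] w′ →
      w 0 ≡ w′ 0 × w (suc L) ≡ w′ (suc L) × (w ∘ suc) ≈[ L ] (w′ ∘ suc)
    ≈-ends (mk≈ h) =
      h 0 (s≤s z≤n) , h (suc L) ≤-refl , mk≈ λ e lt → h (suc e) (s≤s (m≤n⇒m≤1+n lt))

    ≈-from-ends : w 0 ≡ w′ 0 → w (suc L) ≡ w′ (suc L) → (w ∘ suc) ≈[ L ] (w′ ∘ suc) →
      w ≈[ 2 + L ] w′
    ≈-from-ends h₀ hₗ (mk≈ hᵢ) = mk≈ at
      where
      at : ∀ e → e < 2 + L → w e ≡ w′ e
      at zero _ = h₀
      at (suc e) (s≤s lt) with m<1+n⇒m<n∨m≡n lt
      ... | inj₁ e<L = hᵢ e e<L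
      ... | inj₂ refl = hₗ

    ⇄-ends : w ⇄[ 2 + L ] w′ →
      w 0 ≡ w′ (suc L) × w (suc L) ≡ w′ 0 × (w ∘ suc) ⇄[ L ] (w′ ∘ suc)
    ⇄-ends (mk⇄ h) =
      h 0 (s≤s z≤n) ,
      trans (h (suc L) ≤-refl) (cong w′ (n∸n≡0 L)) ,
      mk⇄ λ e lt → trans (h (suc e) (s≤s (m≤n⇒m≤1+n lt))) (cong w′ (∸≡suc-mirror lt))

    ⇄-from-ends : w 0 ≡ w′ (suc L) → w (suc L) ≡ w′ 0 → (w ∘ suc) ⇄[ L ] (w′ ∘ suc) →
      w ⇄[ 2 + L ] w′
    ⇄-from-ends h₀ hₗ (mk⇄ hᵢ) = mk⇄ at
      where
      at : ∀ e → e < 2 + L → w e ≡ w′ (mirror (2 + L) e)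
      at zero _ = h₀
      at (suc e) (s≤s lt) with m<1+n⇒m<n∨m≡n lt
      ... | inj₁ e<L = trans (hᵢ e e<L) (cong w′ (sym (∸≡suc-mirror e<L)))
      ... | inj₂ refl = trans hₗ (cong w′ (sym (n∸n≡0 L)))

  Tuple : ℕ → Set
  Tuple zero = ⊤
  Tuple (suc L) = Fin D × Tuple L

  Tuple↔ : ∀ L → Fin (D ^ L) ↔ Tuple L
  Tuple↔ zero = 1↔⊤
  Tuple↔ (suc L) = ↔-trans (*↔× {D}) (↔-refl ×-↔ Tuple↔ L)

  toWord : ∀ {L} → Tuple L → Word
  toWord {zero} _ _ = zero
  toWord {suc L} (x , _) zero = x
  toWord {suc L} (_ , u) (suc e) = toWord u e

  fromWord : ∀ L → Word → Tuple L
  fromWord zero w = tt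
  fromWord (suc L) w = w 0 , fromWord L (w ∘ suc)

  toWord-fromWord : ∀ L w e → e < L → toWord (fromWord L w) e ≡ w e
  toWord-fromWord (suc L) w zero _ = refl
  toWord-fromWord (suc L) w (suc e) (s≤s lt) = toWord-fromWord L (w ∘ suc) e lt

  toWord-injective : ∀ {L} (u v : Tuple L) → toWord u ≈[ L ] toWord v → u ≡ v
  toWord-injective {zero} tt tt _ = refl
  toWord-injective {suc L} (x , u) (y , v) (mk≈ h) =
    cong₂ _,_ (h 0 (s≤s z≤n)) (toWord-injective u v (mk≈ λ e lt → h (suc e) (s≤s lt)))

  frame : Fin D → Word → Fin D → ℕ → Word
  frame x w y L zero = x
  frame x w y L (suc e) with e <? L
  ... | yes _ = w e
  ... | no _ = y

  frame-inner : ∀ x w y L → (frame x w y L ∘ suc) ≈[ L ] w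
  frame-inner x w y L = mk≈ at
    where
    at : ∀ e → e < L → frame x w y L (suc e) ≡ w e
    at e lt with e <? L
    ... | yes _ = refl
    ... | no e≮L = ⊥-elim (e≮L lt)

  frame-last : ∀ x w y L → frame x w y L (suc L) ≡ y
  frame-last x w y L with L <? L
  ... | yes L<L = ⊥-elim (<-irrefl refl L<L)
  ... | no _ = refl

  -- One representative of each class {w, reversal of w} of non-palindromic words: the end
  -- letters are either an unordered pair of distinct letters (and the middle is arbitrary)
  -- or equal (and the middle is again a representative).
  Canonical : ℕ → Set
  Canonical zero = ⊥
  Canonical (suc zero) = ⊥
  Canonical (suc (suc L)) = (Pair D × Tuple L) ⊎ (Fin D × Canonical L)

  canonicalCount : ℕ → ℕ
  canonicalCount zero = 0
  canonicalCount (suc zero) = 0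
  canonicalCount (suc (suc L)) = triangular D * D ^ L + D * canonicalCount L

  Canonical↔ : ∀ L → Fin (canonicalCount L) ↔ Canonical L
  Canonical↔ zero = 0↔⊥
  Canonical↔ (suc zero) = 0↔⊥
  Canonical↔ (suc (suc L)) =
    ↔-trans (+↔⊎ {triangular D * D ^ L})
      (↔-trans (*↔× {triangular D}) (Pair↔ D ×-↔ Tuple↔ L)
        ⊎-↔ ↔-trans (*↔× {D}) (↔-refl ×-↔ Canonical↔ L))

  first last : ∀ {L} → Canonical (2 + L) → Fin D
  first (inj₁ (p , _)) = lo p
  first (inj₂ (a , _)) = a
  last (inj₁ (p , _)) = hi p
  last (inj₂ (a , _)) = a

  mutual
    spell : ∀ {L} → Canonical L → Word
    spell {suc (suc L)} c = frame (first c) (inner c) (last c) L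

    inner : ∀ {L} → Canonical (2 + L) → Word
    inner (inj₁ (_ , u)) = toWord u
    inner (inj₂ (_ , c)) = spell c

  module _ {L : ℕ} (c : Canonical (2 + L)) where

    spell-last : spell c (suc L) ≡ last c
    spell-last = frame-last (first c) (inner c) (last c) L

    spell-inner : (spell c ∘ suc) ≈[ L ] inner c
    spell-inner = frame-inner (first c) (inner c) (last c) L

    ≈-spell : ∀ {w} → first c ≡ w 0 → last c ≡ w (suc L) → inner c ≈[ L ] (w ∘ suc) →
      spell c ≈[ 2 + L ] w
    ≈-spell e₀ eₗ eᵢ = ≈-from-ends e₀ (trans spell-last eₗ) (≈-trans spell-inner eᵢ)

    ⇄-spell : ∀ {w} → first c ≡ w (suc L) → last c ≡ w 0 → inner c ⇄[ L ] (w ∘ suc) →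
      spell c ⇄[ 2 + L ] w
    ⇄-spell e₀ eₗ eᵢ = ⇄-from-ends e₀ (trans spell-last eₗ) (≈-⇄-trans spell-inner eᵢ)

  module _ {L : ℕ} (c c′ : Canonical (2 + L)) where

    spell-≈ : spell c ≈[ 2 + L ] spell c′ →
      first c ≡ first c′ × last c ≡ last c′ × inner c ≈[ L ] inner c′
    spell-≈ h =
      let h₀ , hₗ , hᵢ = ≈-ends h in
      h₀ , trans (sym (spell-last c)) (trans hₗ (spell-last c′)) ,
      ≈-trans (≈-sym (spell-inner c)) (≈-trans hᵢ (spell-inner c′))

    spell-⇄ : spell c ⇄[ 2 + L ] spell c′ →
      first c ≡ last c′ × last c ≡ first c′ × inner c ⇄[ L ] inner c′
    spell-⇄ h =
      let h₀ , hₗ , hᵢ = ⇄-ends h in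
      trans h₀ (spell-last c′) , trans (sym (spell-last c)) hₗ ,
      ≈-⇄-trans (≈-sym (spell-inner c)) (⇄-≈-trans hᵢ (spell-inner c′))

  spell-injective : ∀ {L} (c c′ : Canonical L) → spell c ≈[ L ] spell c′ → c ≡ c′
  spell-injective {suc (suc L)} c@(inj₁ (p , u)) c′@(inj₁ (q , v)) h =
    let e₀ , eₗ , eᵢ = spell-≈ c c′ h in
    cong₂ (λ p u → inj₁ (p , u)) (Pair-≡ p q e₀ eₗ) (toWord-injective u v eᵢ)
  spell-injective {suc (suc L)} c@(inj₁ (p , _)) c′@(inj₂ _) h =
    let e₀ , eₗ , _ = spell-≈ c c′ h in ⊥-elim (lo≢hi p (trans e₀ (sym eₗ)))
  spell-injective {suc (suc L)} c@(inj₂ _) c′@(inj₁ (q , _)) h =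
    let e₀ , eₗ , _ = spell-≈ c c′ h in ⊥-elim (lo≢hi q (trans (sym e₀) eₗ))
  spell-injective {suc (suc L)} c@(inj₂ (_ , s)) c′@(inj₂ (_ , s′)) h =
    let e₀ , _ , eᵢ = spell-≈ c c′ h in
    cong₂ (λ a s → inj₂ (a , s)) e₀ (spell-injective s s′ eᵢ)

  spell-irreversible : ∀ {L} (c c′ : Canonical L) → ¬ spell c ⇄[ L ] spell c′
  spell-irreversible {suc (suc L)} c@(inj₁ (p , _)) c′@(inj₁ (q , _)) h =
    let e₀ , eₗ , _ = spell-⇄ c c′ h in lo≢hi-swap p q e₀ eₗ
  spell-irreversible {suc (suc L)} c@(inj₁ (p , _)) c′@(inj₂ _) h =
    let e₀ , eₗ , _ = spell-⇄ c c′ h in lo≢hi p (trans e₀ (sym eₗ))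
  spell-irreversible {suc (suc L)} c@(inj₂ _) c′@(inj₁ (q , _)) h =
    let e₀ , eₗ , _ = spell-⇄ c c′ h in lo≢hi q (trans (sym eₗ) e₀)
  spell-irreversible {suc (suc L)} c@(inj₂ (_ , s)) c′@(inj₂ (_ , s′)) h =
    let _ , _ , eᵢ = spell-⇄ c c′ h in spell-irreversible s s′ eᵢ

  canonical : ∀ L w → ¬ w ⇄[ L ] w → Σ (Canonical L) λ c → spell c ~[ L ] w
  canonical zero w asym = ⊥-elim (asym (mk⇄ λ _ ()))
  canonical (suc zero) w asym = ⊥-elim (asym (mk⇄ λ { zero _ → refl ; (suc _) (s≤s ()) }))
  canonical (suc (suc L)) w asym with w 0 Fin.≟ w (suc L)
  ... | no ends≢ with pairOf (w 0) (w (suc L)) ends≢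
  ...   | p , inj₁ (e₀ , eₗ) =
    c , inj₁ (≈-spell c e₀ eₗ (mk≈ (toWord-fromWord L (w ∘ suc))))
    where c : Canonical (2 + L)
          c = inj₁ (p , fromWord L (w ∘ suc))
  ...   | p , inj₂ (e₀ , eₗ) =
    c , inj₂ (⇄-spell c e₀ eₗ (mk⇄ λ e lt →
      trans (toWord-fromWord L v e lt) (cong w (∸≡suc-mirror lt))))
    where v : Word
          v e = w (L ∸ e)
          c : Canonical (2 + L)
          c = inj₁ (p , fromWord L v)
  canonical (suc (suc L)) w asym | yes ends≡
    with canonical L (w ∘ suc) (asym ∘ ⇄-from-ends ends≡ (sym ends≡))
  ... | c , inj₁ h = inj₂ (w 0 , c) , inj₁ (≈-spell (inj₂ (w 0 , c)) refl ends≡ h)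
  ... | c , inj₂ h = inj₂ (w 0 , c) , inj₂ (⇄-spell (inj₂ (w 0 , c)) ends≡ refl h)

  distinctFamily : ∀ {n} L → n ≤ canonicalCount L → Σ (Fin n → Word) (DistinctUpToReversal L)
  distinctFamily L n≤ =
    W , λ a b → (λ h → inject≤-injective n≤ n≤ a b (to-injective (spell-injective _ _ h))) ,
                spell-irreversible _ _
    where
      to = Inverse.to (Canonical↔ L)
      to-injective = Injection.injective (↔⇒↣ (Canonical↔ L))
      W : _ → Word
      W a = spell (to (inject≤ a n≤))

  distinctFamily-bound : ∀ {n} L (W : Fin n → Word) → DistinctUpToReversal L W →
    n ≤ canonicalCount L
  distinctFamily-bound L W distinct =
    injective⇒≤ {f = Inverse.from (Canonical↔ L) ∘ proj₁ ∘ classOf}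
                (classOf-injective ∘ from-injective)
    where
      from-injective = Injection.injective (↔⇒↣ (↔-sym (Canonical↔ L)))
      classOf : ∀ a → Σ (Canonical L) λ c → spell c ~[ L ] W a
      classOf a = canonical L (W a) (proj₂ (distinct a a))
      classOf-injective : ∀ {a b} → proj₁ (classOf a) ≡ proj₁ (classOf b) → a ≡ b
      classOf-injective {a} {b} same with classOf a | classOf b
      ... | c , ha | c′ , hb =
        ~⇒≡ distinct (~-trans (~-sym ha) (subst (λ c → spell c ~[ L ] W b) (sym same) hb))

  -- The D ^ ⌈ L /2⌉ palindromes are the words left over by the pairing w ↦ reversal of w.
  canonicalCount-double : ∀ L → canonicalCount L + canonicalCount L + D ^ ⌈ L /2⌉ ≡ D ^ L
  canonicalCount-double zero = refl
  canonicalCount-double (suc zero) = refl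
  canonicalCount-double (suc (suc L)) = +-cancelʳ-≡ _ _ _ (begin
    (T * X + D * c) + (T * X + D * c) + D * P + D * X  ≡⟨ rearrange T X c P D ⟩
    (T + T + D) * X + D * (c + c + P)                  ≡⟨ cong₂ (λ a b → a * X + D * b)
                                                           (triangular-double D)
                                                           (canonicalCount-double L) ⟩
    D * D * X + D * X                                  ≡⟨ cong (_+ D * X) (*-assoc D D X) ⟩
    D * (D * X) + D * X                                ∎)
    where
    open ≡-Reasoning
    T = triangular D
    X = D ^ L
    c = canonicalCount L
    P = D ^ ⌈ L /2⌉
    rearrange : ∀ T X c P D →
      (T * X + D * c) + (T * X + D * c) + D * P + D * X ≡ (T + T + D) * X + D * (c + c + P)
    rearrange = solve-∀

  canonicalCount≡ : ∀ L → (D ^ L ∸ D ^ ⌈ L /2⌉) / 2 ≡ canonicalCount L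
  canonicalCount≡ L = begin
    (D ^ L ∸ P) / 2          ≡⟨ cong (λ x → (x ∸ P) / 2) (sym (canonicalCount-double L)) ⟩
    (c + c + P ∸ P) / 2      ≡⟨ cong (_/ 2) (m+n∸n≡m (c + c) P) ⟩
    (c + c) / 2              ≡⟨ cong (_/ 2) (x+x≡x*2 c) ⟩
    c * 2 / 2                ≡⟨ m*n/n≡m c 2 ⟩
    c                        ∎
    where
    open ≡-Reasoning
    c = canonicalCount L
    P = D ^ ⌈ L /2⌉
    x+x≡x*2 : ∀ x → x + x ≡ x * 2
    x+x≡x*2 = solve-∀

  d≤canonicalCount : ∀ L → d ≤ canonicalCount (3 + L)
  d≤canonicalCount L =
    ≤-trans (m≤m+n d (triangular d))
      (≤-trans (m≤m*n (triangular D) (D ^ suc L) {{m^n≢0 D (suc L)}}) (m≤m+n _ _))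

module Windmill (n₀ k₀ : ℕ) where

  n K k : ℕ
  n = 2 + n₀
  K = 2 + k₀
  k = suc K

  G : Graph
  G = DutchWindmill n k

  V : Set
  V = WVertex n k

  Adj : V → V → Set
  Adj = WAdj n k

  adj-sym : ∀ {u v} → Adj u v → Adj v u
  adj-sym = Graph.sym G

  centre : V
  centre = inj₁ tt

  -- The vertex at distance s from the centre along cycle a; both blade a 0 and blade a k
  -- are the centre.
  blade : Fin n → ℕ → V
  blade a zero = centre
  blade a (suc s) with s <? K
  ... | yes s<K = inj₂ (a , fromℕ< s<K)
  ... | no _ = centre

  blade-inner : ∀ a s → s < K → Σ (Fin K) λ j → blade a (suc s) ≡ inj₂ (a , j) × toℕ j ≡ s
  blade-inner a s lt with s <? K
  ... | yes s<K = fromℕ< s<K , refl , Fin.toℕ-fromℕ< s<K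
  ... | no s≮K = ⊥-elim (s≮K lt)

  blade-beyond : ∀ a s → K ≤ s → blade a (suc s) ≡ centre
  blade-beyond a s ge with s <? K
  ... | yes s<K = ⊥-elim (<-irrefl refl (<-≤-trans s<K ge))
  ... | no _ = refl

  blade-end : ∀ a → blade a k ≡ centre
  blade-end a = blade-beyond a K ≤-refl

  blade-toℕ : ∀ a (j : Fin K) → blade a (suc (toℕ j)) ≡ inj₂ (a , j)
  blade-toℕ a j with blade-inner a (toℕ j) (Fin.toℕ<n j)
  ... | _ , e , t = trans e (cong (λ x → inj₂ (a , x)) (Fin.toℕ-injective t))

  blade-toℕ≡ : ∀ a (j : Fin K) {t} → toℕ j ≡ t → blade a (suc t) ≡ inj₂ (a , j)
  blade-toℕ≡ a j refl = blade-toℕ a j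

  blade≡inj₂ : ∀ a s c j → blade a s ≡ inj₂ (c , j) → a ≡ c × s ≡ suc (toℕ j)
  blade≡inj₂ a zero c j ()
  blade≡inj₂ a (suc s) c j e with s <? K
  blade≡inj₂ a (suc s) c j refl | yes s<K = refl , cong suc (sym (Fin.toℕ-fromℕ< s<K))
  blade≡inj₂ a (suc s) c j () | no _

  blade-injective : ∀ c t c′ s → t < K → blade c (suc t) ≡ blade c′ s → c′ ≡ c × s ≡ suc t
  blade-injective c t c′ s lt e with blade-inner c t lt
  ... | j , e′ , tj with blade≡inj₂ c′ s c j (trans (sym e) e′)
  ... | c′≡c , s≡ = c′≡c , trans s≡ (cong suc tj)

  blade≢centre : ∀ c s → s < K → blade c (suc s) ≢ centre
  blade≢centre c s lt e with blade-inner c s lt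
  ... | _ , e′ , _ with trans (sym e) e′
  ... | ()

  blade-adjacent : ∀ a s → s ≤ K → Adj (blade a s) (blade a (suc s))
  blade-adjacent a zero _ with blade-inner a 0 (s≤s z≤n)
  ... | _ , e , t = subst (Adj centre) (sym e) (inj₁ t)
  blade-adjacent a (suc s) le with blade-inner a s le | m≤n⇒m<n∨m≡n le
  ... | _ , e , t | inj₁ lt with blade-inner a (suc s) lt
  ...   | _ , e′ , t′ =
    subst₂ Adj (sym e) (sym e′) (refl , inj₁ (trans (cong (_+ 1) t) (trans (+-comm s 1) (sym t′))))
  blade-adjacent a (suc s) le | _ , e , t | inj₂ refl =
    subst₂ Adj (sym e) (sym (blade-end a)) (inj₂ (trans (cong (_+ 2) t) (+-comm s 2)))

  OnBlade : Fin n → ℕ → V → V → Set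
  OnBlade c s u v =
    (u ≡ blade c s × v ≡ blade c (suc s)) ⊎ (u ≡ blade c (suc s) × v ≡ blade c s)

  OnBlade-sym : ∀ {c s u v} → OnBlade c s u v → OnBlade c s v u
  OnBlade-sym (inj₁ (e , e′)) = inj₂ (e′ , e)
  OnBlade-sym (inj₂ (e , e′)) = inj₁ (e′ , e)

  Edge : V → V → Set
  Edge u v = Σ (Fin n) λ c → Σ ℕ λ s → s ≤ K × OnBlade c s u v

  centre-edge : ∀ {c j} → Adj centre (inj₂ (c , j)) → Edge centre (inj₂ (c , j))
  centre-edge {c} {j} (inj₁ t) = c , 0 , z≤n , inj₁ (refl , sym (blade-toℕ≡ c j t))
  centre-edge {c} {j} (inj₂ t) =
    c , K , ≤-refl , inj₂ (sym (blade-end c) , sym (blade-toℕ≡ c j (end-index t)))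
    where end-index : ∀ {t} → t + 2 ≡ k → t ≡ suc k₀
          end-index {t} e = suc-injective (suc-injective (trans (+-comm 2 t) e))

  edge-on-blade : ∀ {u v} → Adj u v → Edge u v
  edge-on-blade {inj₁ _} {inj₂ _} a = centre-edge a
  edge-on-blade {inj₂ _} {inj₁ _} a with centre-edge a
  ... | c , s , le , o = c , s , le , OnBlade-sym o
  edge-on-blade {inj₂ (c , j)} {inj₂ (.c , j′)} (refl , inj₁ t) =
    c , suc (toℕ j) , Fin.toℕ<n j ,
    inj₁ (sym (blade-toℕ c j) , sym (blade-toℕ≡ c j′ (trans (sym t) (+-comm (toℕ j) 1))))
  edge-on-blade {inj₂ (c , j)} {inj₂ (.c , j′)} (refl , inj₂ t) =
    c , suc (toℕ j′) , Fin.toℕ<n j′ ,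
    inj₂ (sym (blade-toℕ≡ c j (trans (sym t) (+-comm (toℕ j′) 1))) , sym (blade-toℕ c j′))

  blade-neighbours : ∀ c t {v} → t < K → Adj (blade c (suc t)) v →
    v ≡ blade c t ⊎ v ≡ blade c (2 + t)
  blade-neighbours c t lt a with edge-on-blade a
  ... | c′ , s , _ , inj₁ (e , e′) with blade-injective c t c′ s lt e
  ...   | refl , refl = inj₂ e′
  blade-neighbours c t lt a | c′ , s , _ , inj₂ (e , e′) with blade-injective c t c′ (suc s) lt e
  ...   | refl , refl = inj₁ e′

  centre-neighbours : ∀ {v} → Adj centre v → Σ (Fin n) λ c → v ≡ blade c 1 ⊎ v ≡ blade c K
  centre-neighbours a with edge-on-blade a
  ... | c , zero , _ , inj₁ (_ , e) = c , inj₁ e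
  ... | c , suc s , le , inj₁ (e , _) = ⊥-elim (blade≢centre c s le (sym e))
  ... | c , s , le , inj₂ (e , e′) with m≤n⇒m<n∨m≡n le
  ...   | inj₁ lt = ⊥-elim (blade≢centre c s lt (sym e))
  ...   | inj₂ refl = c , inj₂ e′

  record InjectiveHom (f : V → V) : Set where
    field
      injective : ∀ {u v} → f u ≡ f v → u ≡ v
      adjacent  : ∀ {u v} → Adj u v → Adj (f u) (f v)

  automorphism⇒injectiveHom : (σ : Automorphism G) → InjectiveHom (Automorphism.fun σ)
  automorphism⇒injectiveHom σ = record
    { injective = λ {u} {v} e → trans (sym (invˡ u)) (trans (cong inv e) (invˡ v))
    ; adjacent = pres
    }
    where open Automorphism σ

  centre-adjacent-end : ∀ a → Adj centre (blade a K)
  centre-adjacent-end a =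
    subst (λ x → Adj x (blade a K)) (blade-end a) (adj-sym (blade-adjacent a K ≤-refl))

  -- A blade vertex has two neighbours, but the centre has the three distinct neighbours
  -- blade 0 1, blade 1 1 and blade 0 K (using n ≥ 2 and k ≥ 3).
  centre-fixed : ∀ {f} → InjectiveHom f → f centre ≡ centre
  centre-fixed {f} hom with f centre in eq
  ... | inj₁ tt = refl
  ... | inj₂ (c , j) =
    ⊥-elim (pigeonhole (image-neighbour (blade-adjacent zero 0 z≤n))
                       (image-neighbour (blade-adjacent (suc zero) 0 z≤n))
                       (image-neighbour (centre-adjacent-end zero)))
    where
      open InjectiveHom hom
      t = toℕ j
      Near : V → Set
      Near x = f x ≡ blade c t ⊎ f x ≡ blade c (2 + t)
      image-neighbour : ∀ {x} → Adj centre x → Near x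
      image-neighbour a =
        blade-neighbours c t (Fin.toℕ<n j)
          (subst (λ y → Adj y _) (trans eq (sym (blade-toℕ c j))) (adjacent a))
      same : ∀ {x y w} → f x ≡ w → f y ≡ w → x ≡ y
      same e e′ = injective (trans e (sym e′))
      0₁≢1₁ : blade zero 1 ≢ blade (suc zero) 1
      0₁≢1₁ e with blade-injective zero 0 (suc zero) 1 (s≤s z≤n) e
      ... | () , _
      0₁≢0ₖ : blade zero 1 ≢ blade zero K
      0₁≢0ₖ e with blade-injective zero 0 zero K (s≤s z≤n) e
      ... | _ , ()
      1₁≢0ₖ : blade (suc zero) 1 ≢ blade zero K
      1₁≢0ₖ e with blade-injective (suc zero) 0 zero K (s≤s z≤n) e
      ... | () , _
      pigeonhole : Near (blade zero 1) → Near (blade (suc zero) 1) → Near (blade zero K) → ⊥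
      pigeonhole (inj₁ x) (inj₁ y) _ = 0₁≢1₁ (same x y)
      pigeonhole (inj₂ x) (inj₂ y) _ = 0₁≢1₁ (same x y)
      pigeonhole (inj₁ x) _ (inj₁ z) = 0₁≢0ₖ (same x z)
      pigeonhole (inj₂ x) _ (inj₂ z) = 0₁≢0ₖ (same x z)
      pigeonhole _ (inj₁ y) (inj₁ z) = 1₁≢0ₖ (same y z)
      pigeonhole _ (inj₂ y) (inj₂ z) = 1₁≢0ₖ (same y z)

  blade-2+≢ : ∀ a s → s < K → blade a (2 + s) ≢ blade a s
  blade-2+≢ a zero le e = blade≢centre a 1 (s≤s (s≤s z≤n)) e
  blade-2+≢ a (suc s) le e with blade-inner a s (<-trans (n<1+n s) le)
  ... | j , e′ , t with blade≡inj₂ a (3 + s) a j (trans e e′)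
  ... | _ , 3+s≡ = 2+m≢m (trans (suc-injective 3+s≡) t)
    where 2+m≢m : ∀ {m} → 2 + m ≢ m
          2+m≢m ()

  -- Injectivity forbids turning back, so the image walks along blade b.
  follow-blade : ∀ {f} → InjectiveHom f → f centre ≡ centre →
    ∀ a b → f (blade a 1) ≡ blade b 1 → ∀ s → s ≤ k → f (blade a s) ≡ blade b s
  follow-blade {f} hom f-centre a b f-first = follow
    where
      open InjectiveHom hom
      step : ∀ s → s ≤ K → f (blade a s) ≡ blade b s × f (blade a (suc s)) ≡ blade b (suc s)
      step zero _ = f-centre , f-first
      step (suc s) le with step s (≤-trans (n≤1+n s) le)
      ... | e , e′ with blade-neighbours b s le
                          (subst (λ x → Adj x _) e′ (adjacent (blade-adjacent a (suc s) le)))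
      ...   | inj₁ back = ⊥-elim (blade-2+≢ a s le (injective (trans back (sym e))))
      ...   | inj₂ forth = e′ , forth
      follow : ∀ s → s ≤ k → f (blade a s) ≡ blade b s
      follow zero _ = f-centre
      follow (suc s) (s≤s le) = proj₂ (step s le)

  flipIf : Bool → Fin K → Fin K
  flipIf true = opposite
  flipIf false j = j

  flipIf-involutive : ∀ r j → flipIf r (flipIf r j) ≡ j
  flipIf-involutive true = Fin.opposite-involutive
  flipIf-involutive false j = refl

  reflectIf : Bool → ℕ → ℕ
  reflectIf true s = k ∸ s
  reflectIf false s = s

  blade-adjacentIf : ∀ c r s → s ≤ K → Adj (blade c (reflectIf r s)) (blade c (reflectIf r (suc s)))
  blade-adjacentIf c false s le = blade-adjacent c s le
  blade-adjacentIf c true s le =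
    subst (λ x → Adj (blade c x) (blade c (K ∸ s))) (sym (∸≡suc-mirror (s≤s le)))
      (adj-sym (blade-adjacent c (K ∸ s) (m∸n≤m K s)))

  -- Exchanges blades a and b, reversing both when r = true; for a = b it reverses one blade.
  module Swap (a b : Fin n) (r : Bool) where

    swapIn : (c : Fin n) → Fin K → Dec (c ≡ a) → Dec (c ≡ b) → V
    swapIn c j (yes _) _ = inj₂ (b , flipIf r j)
    swapIn c j (no _) (yes _) = inj₂ (a , flipIf r j)
    swapIn c j (no _) (no _) = inj₂ (c , j)

    τ : V → V
    τ (inj₁ tt) = centre
    τ (inj₂ (c , j)) = swapIn c j (c Fin.≟ a) (c Fin.≟ b)

    τ-a : ∀ j → τ (inj₂ (a , j)) ≡ inj₂ (b , flipIf r j)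
    τ-a j with a Fin.≟ a
    ... | yes _ = refl
    ... | no a≢a = ⊥-elim (a≢a refl)

    τ-b : ∀ j → τ (inj₂ (b , j)) ≡ inj₂ (a , flipIf r j)
    τ-b j with b Fin.≟ a | b Fin.≟ b
    ... | yes refl | _ = refl
    ... | no _ | yes _ = refl
    ... | no _ | no b≢b = ⊥-elim (b≢b refl)

    τ-other : ∀ c j → c ≢ a → c ≢ b → τ (inj₂ (c , j)) ≡ inj₂ (c , j)
    τ-other c j c≢a c≢b with c Fin.≟ a | c Fin.≟ b
    ... | yes c≡a | _ = ⊥-elim (c≢a c≡a)
    ... | no _ | yes c≡b = ⊥-elim (c≢b c≡b)
    ... | no _ | no _ = refl

    data Role (c : Fin n) : Set where
      first  : c ≡ a → Role c
      second : c ≢ a → c ≡ b → Role c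
      other  : c ≢ a → c ≢ b → Role c

    role : ∀ c → Role c
    role c with c Fin.≟ a | c Fin.≟ b
    ... | yes c≡a | _ = first c≡a
    ... | no c≢a | yes c≡b = second c≢a c≡b
    ... | no c≢a | no c≢b = other c≢a c≢b

    τ-involutive : ∀ v → τ (τ v) ≡ v
    τ-involutive (inj₁ tt) = refl
    τ-involutive (inj₂ (c , j)) with role c
    ... | first refl =
      trans (cong τ (τ-a j)) (trans (τ-b (flipIf r j)) (cong (inj₂ ∘ (c ,_)) (flipIf-involutive r j)))
    ... | second _ refl =
      trans (cong τ (τ-b j)) (trans (τ-a (flipIf r j)) (cong (inj₂ ∘ (c ,_)) (flipIf-involutive r j)))
    ... | other c≢a c≢b = trans (cong τ (τ-other c j c≢a c≢b)) (τ-other c j c≢a c≢b)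

    τ-blade : ∀ c c′ r′ → (∀ j → τ (inj₂ (c , j)) ≡ inj₂ (c′ , flipIf r′ j)) →
      ∀ s → s ≤ k → τ (blade c s) ≡ blade c′ (reflectIf r′ s)
    τ-blade c c′ true _ zero _ = sym (blade-end c′)
    τ-blade c c′ false _ zero _ = refl
    τ-blade c c′ r′ h (suc t) (s≤s le) with m≤n⇒m<n∨m≡n le
    ... | inj₂ refl = trans (cong τ (blade-end c)) (sym (end r′))
      where end : ∀ r′ → blade c′ (reflectIf r′ k) ≡ centre
            end true = cong (blade c′) (n∸n≡0 k)
            end false = blade-end c′
    ... | inj₁ lt with blade-inner c t lt
    ...   | j , e , tj = trans (cong τ e) (trans (h j) (sym (image r′)))
      where image : ∀ r′ → blade c′ (reflectIf r′ (suc t)) ≡ inj₂ (c′ , flipIf r′ j)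
            image false = blade-toℕ≡ c′ j tj
            image true = trans (cong (blade c′) (∸≡suc-mirror lt))
              (blade-toℕ≡ c′ (opposite j) (trans (Fin.opposite-prop j) (cong (λ x → K ∸ suc x) tj)))

    τ-blade-a : ∀ s → s ≤ k → τ (blade a s) ≡ blade b (reflectIf r s)
    τ-blade-a = τ-blade a b r τ-a

    data BladeImage (c : Fin n) : Set where
      onto : ∀ c′ r′ → (∀ s → s ≤ k → τ (blade c s) ≡ blade c′ (reflectIf r′ s)) → BladeImage c

    bladeImage : ∀ c → BladeImage c
    bladeImage c with role c
    ... | first refl = onto b r τ-blade-a
    ... | second _ refl = onto a r (τ-blade c a r τ-b)
    ... | other c≢a c≢b = onto c false (τ-blade c c false (λ j → τ-other c j c≢a c≢b))

    τ-adjacent : ∀ {u v} → Adj u v → Adj (τ u) (τ v)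
    τ-adjacent a with edge-on-blade a
    ... | c , s , le , o with bladeImage c | o
    ... | onto c′ r′ h | inj₁ (refl , refl) =
      subst₂ Adj (sym (h s (m≤n⇒m≤1+n le))) (sym (h (suc s) (s≤s le))) (blade-adjacentIf c′ r′ s le)
    ... | onto c′ r′ h | inj₂ (refl , refl) =
      subst₂ Adj (sym (h (suc s) (s≤s le))) (sym (h s (m≤n⇒m≤1+n le)))
        (adj-sym (blade-adjacentIf c′ r′ s le))

    swap : Automorphism G
    swap = record
      { fun = τ ; inv = τ ; invˡ = τ-involutive ; invʳ = τ-involutive ; pres = τ-adjacent
      ; reflect = λ {u} {v} a → subst₂ Adj (τ-involutive u) (τ-involutive v) (τ-adjacent a)
      }

  follow-blade-reversed : ∀ {f} → InjectiveHom f → f centre ≡ centre →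
    ∀ a b → f (blade a 1) ≡ blade b K → ∀ s → s ≤ k → f (blade a s) ≡ blade b (k ∸ s)
  follow-blade-reversed {f} hom f-centre a b f-first s le =
    trans (sym (τ-involutive _)) (trans (cong τ (follow s le)) (τ-blade-a s le))
    where
      open InjectiveHom hom
      open Swap b b true
      reflected : InjectiveHom (τ ∘ f)
      reflected = record
        { injective = λ {u} {v} e →
            injective (trans (sym (τ-involutive (f u))) (trans (cong τ e) (τ-involutive (f v))))
        ; adjacent = τ-adjacent ∘ adjacent
        }
      follow = follow-blade reflected (cong τ f-centre) a b
        (trans (cong τ f-first) (trans (τ-blade-a K (n≤1+n K)) (cong (blade b) (m+n∸n≡m 1 K))))

  module Labelled (d : ℕ) where
    open Words d

    bladeWord : EdgeLabeling G D → Fin n → Word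
    bladeWord ℓ c s = EdgeLabeling.label ℓ (blade c s) (blade c (suc s))

    mirrorIf : Bool → ℕ → ℕ
    mirrorIf true = mirror k
    mirrorIf false s = s

    module _ (ℓ : EdgeLabeling G D) where
      open EdgeLabeling ℓ

      label-reflectIf : ∀ c r s → s ≤ K →
        label (blade c (reflectIf r s)) (blade c (reflectIf r (suc s)))
          ≡ bladeWord ℓ c (mirrorIf r s)
      label-reflectIf c false s le = refl
      label-reflectIf c true s le =
        trans (cong (λ x → label (blade c x) (blade c (K ∸ s))) (∸≡suc-mirror (s≤s le)))
          (sym (labelSym (blade-adjacent c (K ∸ s) (m∸n≤m K s))))

      module _ (a b : Fin n) (r : Bool)
               (b≡a : ∀ s → s ≤ K → bladeWord ℓ b (mirrorIf r s) ≡ bladeWord ℓ a s)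
               (a≡b : ∀ s → s ≤ K → bladeWord ℓ a (mirrorIf r s) ≡ bladeWord ℓ b s) where
        open Swap a b r

        τ-label : ∀ c s → s ≤ K → label (τ (blade c s)) (τ (blade c (suc s))) ≡ bladeWord ℓ c s
        τ-label c s le with role c
        ... | first refl =
          trans (cong₂ label (τ-blade-a s (m≤n⇒m≤1+n le)) (τ-blade-a (suc s) (s≤s le)))
            (trans (label-reflectIf b r s le) (b≡a s le))
        ... | second _ refl =
          trans (cong₂ label (τ-blade c a r τ-b s (m≤n⇒m≤1+n le))
                             (τ-blade c a r τ-b (suc s) (s≤s le)))
            (trans (label-reflectIf a r s le) (a≡b s le))
        ... | other c≢a c≢b =
          cong₂ label (τ-blade c c false (λ j → τ-other c j c≢a c≢b) s (m≤n⇒m≤1+n le))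
                      (τ-blade c c false (λ j → τ-other c j c≢a c≢b) (suc s) (s≤s le))

        swap-preserves : Preserves swap ℓ
        swap-preserves a with edge-on-blade a
        ... | c , s , le , inj₁ (refl , refl) = τ-label c s le
        ... | c , s , le , inj₂ (refl , refl) =
          trans (labelSym (τ-adjacent a)) (trans (τ-label c s le) (labelSym (adj-sym a)))

      swap-preserves-≈ : ∀ {a b} → bladeWord ℓ a ≈[ k ] bladeWord ℓ b →
        Preserves (Swap.swap a b false) ℓ
      swap-preserves-≈ {a} {b} (mk≈ h) =
        swap-preserves a b false (λ s le → sym (h s (s≤s le))) (λ s le → h s (s≤s le))

      swap-preserves-⇄ : ∀ {a b} → bladeWord ℓ a ⇄[ k ] bladeWord ℓ b →
        Preserves (Swap.swap a b true) ℓ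
      swap-preserves-⇄ {a} {b} h =
        swap-preserves a b true (λ s le → sym (⇄-at h s (s≤s le)))
                                (λ s le → sym (⇄-at (⇄-sym h) s (s≤s le)))

      module _ (σ : Automorphism G) (preserved : Preserves σ ℓ) where
        open Automorphism σ using (fun)

        follow⇒≈ : ∀ {a b} → (∀ s → s ≤ k → fun (blade a s) ≡ blade b s) →
          bladeWord ℓ a ≈[ k ] bladeWord ℓ b
        follow⇒≈ {a} follow = mk≈ λ where
          s (s≤s le) → trans (sym (preserved (blade-adjacent a s le)))
                         (cong₂ label (follow s (m≤n⇒m≤1+n le)) (follow (suc s) (s≤s le)))

        follow⇒⇄ : ∀ {a b} → (∀ s → s ≤ k → fun (blade a s) ≡ blade b (k ∸ s)) →
          bladeWord ℓ a ⇄[ k ] bladeWord ℓ b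
        follow⇒⇄ {a} {b} follow = mk⇄ λ where
          s (s≤s le) → trans (sym (preserved (blade-adjacent a s le)))
                         (trans (cong₂ label (follow s (m≤n⇒m≤1+n le)) (follow (suc s) (s≤s le)))
                           (label-reflectIf b true s le))

    -- A swap of two blades with equal (or mutually reversed) words, or the reflection of a
    -- palindromic blade, preserves the labeling but moves blade a 1.
    bladeWords-distinct : (ℓ : EdgeLabeling G D) → Distinguishing ℓ →
      DistinctUpToReversal k (bladeWord ℓ)
    bladeWords-distinct ℓ distinguishing a b = same-word , reversed-word
      where
        same-word : bladeWord ℓ a ≈[ k ] bladeWord ℓ b → a ≡ b
        same-word h with a Fin.≟ b
        ... | yes a≡b = a≡b
        ... | no a≢b = ⊥-elim (a≢b (sym (proj₁ (blade-injective a 0 b 1 (s≤s z≤n) moved))))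
          where
            open Swap a b false
            moved : blade a 1 ≡ blade b 1
            moved = trans (sym (distinguishing swap (swap-preserves-≈ ℓ h) (blade a 1)))
                          (τ-blade-a 1 (s≤s z≤n))
        reversed-word : ¬ bladeWord ℓ a ⇄[ k ] bladeWord ℓ b
        reversed-word h with blade-injective a 0 b K (s≤s z≤n) moved
          where
            open Swap a b true
            moved : blade a 1 ≡ blade b K
            moved = trans (sym (distinguishing swap (swap-preserves-⇄ ℓ h) (blade a 1)))
                          (τ-blade-a 1 (s≤s z≤n))
        ... | _ , ()

    centreLabel : (Fin n → Word) → Fin n → Fin K → Fin D
    centreLabel W c zero = W c 0
    centreLabel W c (suc _) = W c K

    -- Blade vertex (c , j) is blade c (suc (toℕ j)); the edge {blade c s, blade c (suc s)}
    -- carries the letter W c s.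
    wordLabel : (Fin n → Word) → V → V → Fin D
    wordLabel W (inj₁ _) (inj₁ _) = zero
    wordLabel W (inj₁ _) (inj₂ (c , j)) = centreLabel W c j
    wordLabel W (inj₂ (c , j)) (inj₁ _) = centreLabel W c j
    wordLabel W (inj₂ (c , j)) (inj₂ (_ , j′)) = W c (suc (toℕ j ⊓ toℕ j′))

    wordLabeling : (Fin n → Word) → EdgeLabeling G D
    wordLabeling W = record { label = wordLabel W ; labelSym = sym-on-edges }
      where
        sym-on-edges : ∀ {u v} → Adj u v → wordLabel W u v ≡ wordLabel W v u
        sym-on-edges {inj₁ _} {inj₂ _} _ = refl
        sym-on-edges {inj₂ _} {inj₁ _} _ = refl
        sym-on-edges {inj₂ (c , j)} {inj₂ (.c , j′)} (refl , _) =
          cong (λ x → W c (suc x)) (⊓-comm (toℕ j) (toℕ j′))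

    bladeWord-wordLabeling : ∀ W c → bladeWord (wordLabeling W) c ≈[ k ] W c
    bladeWord-wordLabeling W c = mk≈ λ where s (s≤s le) → letter s le
      where
        letter : ∀ s → s ≤ K → wordLabel W (blade c s) (blade c (suc s)) ≡ W c s
        letter zero _ with blade-inner c 0 (s≤s z≤n)
        ... | zero , e , _ = cong (wordLabel W centre) e
        letter (suc t) le with blade-inner c t le | m≤n⇒m<n∨m≡n le
        ... | j , e , tj | inj₁ lt with blade-inner c (suc t) lt
        ...   | _ , e′ , tj′ =
          trans (cong₂ (wordLabel W) e e′)
            (cong (λ x → W c (suc x)) (trans (cong₂ _⊓_ tj tj′) (m≤n⇒m⊓n≡m (n≤1+n t))))
        letter (suc t) le | suc _ , e , _ | inj₂ refl =
          cong₂ (wordLabel W) e (blade-end c)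

    -- An automorphism fixes the centre and maps blade a onto some blade b, forwards or
    -- backwards; preserving the labels makes W a equal to W b or to its reversal.
    wordLabeling-distinguishing : ∀ W → DistinctUpToReversal k W → Distinguishing (wordLabeling W)
    wordLabeling-distinguishing W distinct σ preserved = fixed
      where
        open Automorphism σ using (fun)
        hom = automorphism⇒injectiveHom σ
        open InjectiveHom hom
        ℓ = wordLabeling W
        fun-centre : fun centre ≡ centre
        fun-centre = centre-fixed hom
        blade-fixed : ∀ a s → s ≤ k → fun (blade a s) ≡ blade a s
        blade-fixed a with centre-neighbours
                             (subst (λ x → Adj x (fun (blade a 1))) fun-centre
                               (adjacent (blade-adjacent a 0 z≤n)))
        ... | b , inj₁ e = subst (λ b → ∀ s → s ≤ k → fun (blade a s) ≡ blade b s) (sym a≡b) follow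
          where
            follow = follow-blade hom fun-centre a b e
            a≡b : a ≡ b
            a≡b = proj₁ (distinct a b)
              (≈-trans (≈-sym (bladeWord-wordLabeling W a))
                (≈-trans (follow⇒≈ ℓ σ preserved follow) (bladeWord-wordLabeling W b)))
        ... | b , inj₂ e = ⊥-elim (proj₂ (distinct a b)
              (≈-⇄-trans (≈-sym (bladeWord-wordLabeling W a))
                (⇄-≈-trans (follow⇒⇄ ℓ σ preserved (follow-blade-reversed hom fun-centre a b e))
                  (bladeWord-wordLabeling W b))))
        fixed : ∀ v → fun v ≡ v
        fixed (inj₁ tt) = fun-centre
        fixed (inj₂ (a , j)) = trans (cong fun (sym (blade-toℕ a j)))
          (trans (blade-fixed a (suc (toℕ j)) (m≤n⇒m≤1+n (Fin.toℕ<n j))) (blade-toℕ a j))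

  distinguishing⇒windmillCond : ∀ r → HasDistinguishingEdgeLabeling G r → WindmillCond n k r
  distinguishing⇒windmillCond zero (ℓ , _) with EdgeLabeling.label ℓ centre centre
  ... | ()
  distinguishing⇒windmillCond (suc d) (ℓ , distinguishing) =
    subst (n ≤_) (sym (canonicalCount≡ k))
      (distinctFamily-bound k (bladeWord ℓ) (bladeWords-distinct ℓ distinguishing))
    where open Words d
          open Labelled d

  windmillCond⇒distinguishing : ∀ r → WindmillCond n k r → HasDistinguishingEdgeLabeling G r
  windmillCond⇒distinguishing zero ()
  windmillCond⇒distinguishing (suc d) cond =
    let W , distinct = distinctFamily k (subst (n ≤_) (canonicalCount≡ k) cond)
    in wordLabeling W , wordLabeling-distinguishing W distinct
    where open Words d
          open Labelled d

  windmillCond-witness : WindmillCond n k (suc n)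
  windmillCond-witness = subst (n ≤_) (sym (canonicalCount≡ k)) (d≤canonicalCount k₀)
    where open Words n

module _ {P : ℕ → Set} (P? : ∀ m → Dec (P m)) where

  least-below : ∀ b → (∀ j → j < b → ¬ P j) ⊎ Σ ℕ (IsLeast P)
  least-below zero = inj₁ λ _ ()
  least-below (suc b) with least-below b | P? b
  ... | inj₂ least | _ = inj₂ least
  ... | inj₁ none | yes p = inj₂ (b , p , none)
  ... | inj₁ none | no ¬p = inj₁ λ j j<1+b → case (m<1+n⇒m<n∨m≡n j<1+b)
    where case : ∀ {j} → j < b ⊎ j ≡ b → ¬ P j
          case (inj₁ j<b) = none _ j<b
          case (inj₂ refl) = ¬p

  least-exists : ∀ m → P m → Σ ℕ (IsLeast P)
  least-exists m p with least-below (suc m)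
  ... | inj₁ none = ⊥-elim (none m ≤-refl p)
  ... | inj₂ least = least

theorem2p2 : (n k : ℕ) → 2 ≤ n → 3 ≤ k →
    Σ ℕ (λ m → DistinguishingIndexIs (DutchWindmill n k) m × IsLeast (WindmillCond n k) m)
theorem2p2 (suc (suc n₀)) (suc (suc (suc k₀))) (s≤s (s≤s z≤n)) (s≤s (s≤s (s≤s z≤n))) =
  let open Windmill n₀ k₀
      m , least = least-exists {P = WindmillCond n k} (λ r → n ≤? (r ^ k ∸ r ^ ⌈ k /2⌉) / 2)
                    (suc n) windmillCond-witness
      cond , below = least
  in m , (windmillCond⇒distinguishing m cond ,
          λ j j<m → below j j<m ∘ distinguishing⇒windmillCond j) ,
     least
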